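{- For each $i\in\{0,\dots,n\}$, the map $\phi:(\pi_0,\dots,\pi_{s-1},0_{c_{b_i}})\mapsto(\pi_0,\dots,\pi_{s-1},\omega_i)$ is a bijection from $\mathcal P_{i,\rho}$ onto $\mathcal P^{\omega_i}_\rho$.
   Context: $\overline{[n]}=\{1<\dots<n<\overline n<\dots<\overline1\}$, $\overline{\overline k}=k$, $\overline{n+1}:=n$, $\chi$ = truth value. $\mathcal B=\{\emptyset\}\sqcup\{(x,y):x\le y\in\overline{[n]}\}$, $H(\emptyset\otimes\emptyset)=0$, $H(\emptyset\otimes(x,y))=H((x,y)\otimes\emptyset)=1$, $H((x,y)\otimes(x',y'))=\chi(x\ge x')+\chi(y\ge y')-\chi(y\ge y'>x\ge x')$ if $\overline{y'}\ne x$, $=\chi(x>x')+\chi(y>y')-\chi(y>y'>x>x')$ if $\overline{y'}=x$. Colours $c_b$ ($b\in\mathcal B$), $c_{x,y}:=c_{(x,y)}$, $\mathcal S=\{c_{x,y}\}$, $c_\infty$ a new colour; $b_0=\emptyset$, $b_k=(k,\overline k)$. $\rho_i(c_{b_i},c_\infty)=1$, $\rho_i(c_b,c_\infty)=H(b_i\otimes b)$ for $c_b\in\mathcal S\setminus\{c_{b_i}\}$, $\rho_i(c_{x',y'},c_{x,y})=\chi(x\ge x')+\chi(y\ge y')-\chi(y\ge y'>x\ge x')=:\rho(c_{x',y'},c_{x,y})$. $\mathcal P_{i,\rho}$: sequences $(\pi_0,\dots,\pi_{s-1},0_{c_{b_i}})$ of coloured integers $k_c$ with $c(\pi_j)\in\mathcal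 S$ for $j<s$ such that, reading the last part as $0_{c_\infty}$, $|\pi_j|-|\pi_{j+1}|\ge\rho_i(c(\pi_j),c(\pi_{j+1}))$. $\omega_0=(-1)_{c_{\overline1,\overline1}}$, $\omega_i=0_{c_{i,\overline{i+1}}}$ ($i\ge1$). $k_c\gg_\rho l_d$ iff $k-l\ge\rho(c,d)$; $\mathcal P^{\omega}_\rho$ is the set of sequences $(\pi_0,\dots,\pi_{s-1},\omega)$ of coloured integers with colours in $\mathcal S$ such that consecutive parts are related by $\gg_\rho$. -}

module Defs where

open import Data.Nat as ℕ using (ℕ; zero; suc; NonZero)
open import Data.Nat.Properties using (≤-refl; ≤-trans; <⇒≤; m≤m+n; ≤-irrelevant)
open import Data.Fin as Fin using (Fin; toℕ; fromℕ<)
open import Data.Fin.Properties using (toℕ<n)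
open import Data.Integer as ℤ using (ℤ; _-_; _+_; 0ℤ; 1ℤ; -1ℤ)
open import Data.Product using (Σ; _×_; _,_; proj₁; proj₂)
open import Data.Product.Relation.Binary.Pointwise.NonDependent using ()
open import Relation.Nullary.Decidable using (Dec; yes; no; _×-dec_)
open import Relation.Binary.Definitions using (DecidableEquality)
open import Relation.Binary.PropositionalEquality using (_≡_; refl; cong)
open import Data.List using (List; []; _∷_; _++_; map; [_])
open import Data.List.Relation.Unary.Linked using (Linked)

-- The ordered alphabet  [n]‾ = {1 < … < n < n̄ < … < 1̄}
-- un k  is the letter  (toℕ k + 1),   ba k  is the letter  overline(toℕ k + 1).

data Letter (n : ℕ) : Set where
  un : Fin n → Letter n
  ba : Fin n → Letter n

rank : ∀ {n} → Letter n → ℕ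
rank (un k) = toℕ k
rank {n} (ba k) = n ℕ.+ (n ℕ.∸ suc (toℕ k))

_≤L_ : ∀ {n} → Letter n → Letter n → Set
x ≤L y = rank x ℕ.≤ rank y

_<L_ : ∀ {n} → Letter n → Letter n → Set
x <L y = rank x ℕ.< rank y

_≤L?_ : ∀ {n} (x y : Letter n) → Dec (x ≤L y)
x ≤L? y = rank x ℕ.≤? rank y

_<L?_ : ∀ {n} (x y : Letter n) → Dec (x <L y)
x <L? y = rank x ℕ.<? rank y

bar : ∀ {n} → Letter n → Letter n
bar (un k) = ba k
bar (ba k) = un k

_≟L_ : ∀ {n} → DecidableEquality (Letter n)
un k ≟L un k' with k Fin.≟ k'
... | yes refl = yes refl
... | no ne = no λ { refl → ne refl }
un k ≟L ba k' = no λ ()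
ba k ≟L un k' = no λ ()
ba k ≟L ba k' with k Fin.≟ k'
... | yes refl = yes refl
... | no ne = no λ { refl → ne refl }

-- The set B = {∅} ⊔ {(x,y) : x ≤ y}.  SCol n is {(x,y) : x ≤ y}, i.e. the
-- colours c_{x,y} forming 𝒮; BCol n is B (colours c_b, b ∈ B).

record SCol (n : ℕ) : Set where
  constructor col
  field
    fst : Letter n
    snd : Letter n
    ordered : fst ≤L snd

data BCol (n : ℕ) : Set where
  ∅ : BCol n
  ⟨_⟩ : SCol n → BCol n

_≟S_ : ∀ {n} → DecidableEquality (SCol n)
col x y p ≟S col x' y' p' with x ≟L x' | y ≟L y'
... | yes refl | yes refl = yes (cong (col x y) (≤-irrelevant p p'))
... | no ne | _ = no λ { refl → ne refl }
... | yes _ | no ne = no λ { refl → ne refl }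

_≟B_ : ∀ {n} → DecidableEquality (BCol n)
∅ ≟B ∅ = yes refl
∅ ≟B ⟨ _ ⟩ = no λ ()
⟨ _ ⟩ ≟B ∅ = no λ ()
⟨ c ⟩ ≟B ⟨ d ⟩ with c ≟S d
... | yes refl = yes refl
... | no ne = no λ { refl → ne refl }

χ : ∀ {P : Set} → Dec P → ℤ
χ (yes _) = 1ℤ
χ (no _) = 0ℤ

H : ∀ {n} → BCol n → BCol n → ℤ
H ∅ ∅ = 0ℤ
H ∅ ⟨ _ ⟩ = 1ℤ
H ⟨ _ ⟩ ∅ = 1ℤ
H ⟨ col x y _ ⟩ ⟨ col x' y' _ ⟩ with bar y' ≟L x
... | no _ = χ (x' ≤L? x) + χ (y' ≤L? y)
             - χ (y' ≤L? y ×-dec x <L? y' ×-dec x' ≤L? x)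
... | yes _ = χ (x' <L? x) + χ (y' <L? y)
              - χ (y' <L? y ×-dec x <L? y' ×-dec x' <L? x)

ρ : ∀ {n} → SCol n → SCol n → ℤ
ρ (col x' y' _) (col x y _) =
  χ (x' ≤L? x) + χ (y' ≤L? y) - χ (y' ≤L? y ×-dec x <L? y' ×-dec x' ≤L? x)

-- b_0 = ∅, b_k = (k, k̄) for i = k ∈ {1..n}  (i : Fin (suc n) encodes {0..n})

un≤ba : ∀ {n} (j : Fin n) → un j ≤L ba j
un≤ba {n} j = ≤-trans (<⇒≤ (toℕ<n j)) (m≤m+n n _)

b : ∀ {n} → Fin (suc n) → BCol n
b Fin.zero = ∅
b (Fin.suc j) = ⟨ col (un j) (ba j) (un≤ba j) ⟩

-- for the letter i = un j (i = toℕ j + 1), barNext j is overline(i+1),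
-- with the convention overline(n+1) := n.
barNext : ∀ {n} → Fin n → Letter n
barNext {n} j with suc (toℕ j) ℕ.<? n
... | yes p = ba (fromℕ< p)
... | no _ = un j

un≤barNext : ∀ {n} (j : Fin n) → un j ≤L barNext j
un≤barNext {n} j with suc (toℕ j) ℕ.<? n
... | yes p = ≤-trans (<⇒≤ (toℕ<n j)) (m≤m+n n _)
... | no _ = ≤-refl

CI : ℕ → Set
CI n = ℤ × SCol n

_≫_ : ∀ {n} → CI n → CI n → Set
(k , c) ≫ (l , d) = ρ c d ℤ.≤ k - l

one : ∀ {n} {{_ : NonZero n}} → Fin n
one {suc n} = Fin.zero

ω : ∀ {n} {{_ : NonZero n}} → Fin (suc n) → CI n
ω Fin.zero = -1ℤ , col (ba one) (ba one) ≤-refl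
ω (Fin.suc j) = 0ℤ , col (un j) (barNext j) (un≤barNext j)

data ExtCol (n : ℕ) : Set where
  fin : SCol n → ExtCol n
  c∞ : ExtCol n

ρ∞ : ∀ {n} → Fin (suc n) → SCol n → ℤ
ρ∞ i c with ⟨ c ⟩ ≟B b i
... | yes _ = 1ℤ
... | no _ = H (b i) ⟨ c ⟩

ρ[_] : ∀ {n} → Fin (suc n) → ExtCol n → ExtCol n → ℤ
ρ[ i ] (fin c) (fin d) = ρ c d
ρ[ i ] (fin c) c∞ = ρ∞ i c
ρ[ i ] c∞ _ = 0ℤ   -- never used: c_∞ only occurs as the colour of the last part

_≫[_]_ : ∀ {n} → ℤ × ExtCol n → Fin (suc n) → ℤ × ExtCol n → Set
(k , c) ≫[ i ] (l , d) = ρ[ i ] c d ℤ.≤ k - l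

ext : ∀ {n} → CI n → ℤ × ExtCol n
ext (k , c) = k , fin c

-- Sequences (π_0, …, π_{s-1}, last): the parts π_j (colours in 𝒮) and the
-- last part (a coloured integer with colour in B).

Seq : ℕ → Set
Seq n = List (CI n) × (ℤ × BCol n)

-- membership in 𝒫_{i,ρ}: last part is 0_{c_{b_i}}, and reading it as 0_{c_∞},
-- consecutive differences satisfy |π_j| − |π_{j+1}| ≥ ρ_i(c(π_j), c(π_{j+1})).
InP : ∀ {n} → Fin (suc n) → Seq n → Set
InP i (πs , last) =
  last ≡ (0ℤ , b i) × Linked (λ p q → p ≫[ i ] q) (map ext πs ++ [ 0ℤ , c∞ ])

𝒫 : (n : ℕ) → Fin (suc n) → Set
𝒫 n i = Σ (Seq n) (InP i)

asLast : ∀ {n} → CI n → ℤ × BCol n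
asLast (k , c) = k , ⟨ c ⟩

InPω : ∀ {n} → CI n → Seq n → Set
InPω w (πs , last) = last ≡ asLast w × Linked _≫_ (πs ++ [ w ])

𝒫^ : (n : ℕ) → CI n → Set
𝒫^ n w = Σ (Seq n) (InPω w)

-- The map only replaces the last part, so it is a bijection as soon as, for
-- every coloured integer x, the condition x ≫ 0_{c_∞} under ρ_i is equivalent
-- to x ≫_ρ ω_i. For i ≥ 1 (where |ω_i| = 0) this is the identity
-- ρ_i(c_b, c_∞) = ρ(c_b, c_{i, overline(i+1)}): the letter overline(i+1) is the
-- predecessor of ī, so y ≤ ī and y ≤ overline(i+1) agree unless y = ī; in
-- that case b ≠ b_i forces x ≠ i, and the strict inequalities in the second
-- branch of H give the same value. For i = 0 both conditions say |x| ≥ 1, since ρ(c, c_{1̄,1̄}) = 2 for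
-- every colour c.

module Submission where

open import Defs
open import Data.Nat as ℕ using (ℕ; suc; NonZero)
import Data.Nat.Properties as ℕₚ
open import Data.Fin as Fin using (Fin; toℕ; fromℕ<)
open import Data.Fin.Properties using (toℕ<n; toℕ-injective; toℕ-fromℕ<)
open import Data.Integer as ℤ using (ℤ; _+_; _-_; -_; 0ℤ; 1ℤ)
import Data.Integer.Properties as ℤₚ
open import Data.Product using (Σ; _×_; _,_; proj₁; proj₂; map₁)
open import Data.List using ([]; _∷_; _++_; map; [_])
open import Data.List.Relation.Unary.Linked as Linked using (Linked; []; [-]; _∷_)
open import Function.Base using (_on_; _∘_)
open import Function.Bundles using (_⇔_; mk⇔; Equivalence)
open import Function.Definitions using (Bijective)
import Function.Properties.Equivalence as ⇔
open import Relation.Unary using (Irrelevant)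
open import Relation.Nullary using (Dec; yes; no; ¬_; _×-dec_; contradiction)
open import Relation.Binary.PropositionalEquality
  using (_≡_; _≢_; refl; sym; trans; cong; cong₂; subst; subst₂; module ≡-Reasoning)

χ-cong : ∀ {P Q : Set} (p : Dec P) (q : Dec Q) → (P → Q) → (Q → P) → χ p ≡ χ q
χ-cong (yes _) (yes _) _ _ = refl
χ-cong (yes p) (no ¬q) f _ = contradiction (f p) ¬q
χ-cong (no ¬p) (yes q) _ g = contradiction (g q) ¬p
χ-cong (no _)  (no _)  _ _ = refl

χ-yes : ∀ {P : Set} (p : Dec P) → P → χ p ≡ 1ℤ
χ-yes p x = χ-cong p (yes x) (λ _ → x) (λ _ → x)

χ-no : ∀ {P : Set} (p : Dec P) → ¬ P → χ p ≡ 0ℤ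
χ-no p ¬x = χ-cong p (no ¬x) (λ x → x) (λ x → x)

rank-injective : ∀ {n} {x y : Letter n} → rank x ≡ rank y → x ≡ y
rank-injective {x = un k} {un k'} e = cong un (toℕ-injective e)
rank-injective {n} {un k} {ba k'} e =
  contradiction e (ℕₚ.<⇒≢ (ℕₚ.<-≤-trans (toℕ<n k) (ℕₚ.m≤m+n n _)))
rank-injective {n} {ba k} {un k'} e =
  contradiction (sym e) (ℕₚ.<⇒≢ (ℕₚ.<-≤-trans (toℕ<n k') (ℕₚ.m≤m+n n _)))
rank-injective {n} {ba k} {ba k'} e = cong ba (toℕ-injective (ℕₚ.suc-injective (begin
  suc (toℕ k)                ≡⟨ ℕₚ.m∸[m∸n]≡n (toℕ<n k) ⟨
  n ℕ.∸ (n ℕ.∸ suc (toℕ k))  ≡⟨ cong (n ℕ.∸_) (ℕₚ.+-cancelˡ-≡ n _ _ e) ⟩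
  n ℕ.∸ (n ℕ.∸ suc (toℕ k')) ≡⟨ ℕₚ.m∸[m∸n]≡n (toℕ<n k') ⟩
  suc (toℕ k')               ∎)))
  where open ≡-Reasoning

≤L∧≢⇒<L : ∀ {n} {x y : Letter n} → x ≤L y → x ≢ y → x <L y
≤L∧≢⇒<L x≤y x≢y = ℕₚ.≤∧≢⇒< x≤y (x≢y ∘ rank-injective)

≤L-1̄ : ∀ {m} (x : Letter (suc m)) → x ≤L ba Fin.zero
≤L-1̄ {m} (un k) = ℕₚ.≤-trans (ℕₚ.≤-pred (toℕ<n k)) (ℕₚ.m≤n+m m (suc m))
≤L-1̄ {m} (ba k) = ℕₚ.+-monoʳ-≤ (suc m) (ℕₚ.m∸n≤m m (toℕ k))

rank-barNext : ∀ {n} (j : Fin n) → suc (rank (barNext j)) ≡ rank (ba j)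
rank-barNext {n} j with suc (toℕ j) ℕ.<? n
... | yes p = begin
  suc (n ℕ.+ (n ℕ.∸ suc (toℕ (fromℕ< p)))) ≡⟨ ℕₚ.+-suc n _ ⟨
  n ℕ.+ suc (n ℕ.∸ suc (toℕ (fromℕ< p)))
    ≡⟨ cong (λ t → n ℕ.+ suc (n ℕ.∸ suc t)) (toℕ-fromℕ< p) ⟩
  n ℕ.+ suc (n ℕ.∸ suc (suc (toℕ j)))      ≡⟨ cong (n ℕ.+_) (ℕₚ.+-∸-assoc 1 p) ⟨
  n ℕ.+ (n ℕ.∸ suc (toℕ j))                ∎
  where open ≡-Reasoning
... | no ¬p = begin
  suc (toℕ j)                  ≡⟨ last ⟩
  n                            ≡⟨ ℕₚ.+-identityʳ n ⟨
  n ℕ.+ 0                      ≡⟨ cong (n ℕ.+_) (ℕₚ.n∸n≡0 n) ⟨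
  n ℕ.+ (n ℕ.∸ n)              ≡⟨ cong (λ t → n ℕ.+ (n ℕ.∸ t)) last ⟨
  n ℕ.+ (n ℕ.∸ suc (toℕ j))    ∎
  where
  open ≡-Reasoning
  last : suc (toℕ j) ≡ n
  last = ℕₚ.≤∧≮⇒≡ (toℕ<n j) ¬p

barNext<ba : ∀ {n} (j : Fin n) → barNext j <L ba j
barNext<ba j = ℕₚ.≤-reflexive (rank-barNext j)

≤ba⇒≤barNext : ∀ {n} {y : Letter n} (j : Fin n) → y ≢ ba j → y ≤L ba j → y ≤L barNext j
≤ba⇒≤barNext {y = y} j y≢j̄ y≤j̄ =
  ℕₚ.≤-pred (subst (rank y ℕ.<_) (sym (rank-barNext j)) (≤L∧≢⇒<L y≤j̄ y≢j̄))

ρ-ω₀≡2 : ∀ {m} (c : SCol (suc m)) → ρ c (proj₂ (ω Fin.zero)) ≡ ℤ.+ 2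
ρ-ω₀≡2 (col x y _) = cong₂ _-_
  (cong₂ _+_ (χ-yes (x ≤L? ba Fin.zero) (≤L-1̄ x)) (χ-yes (y ≤L? ba Fin.zero) (≤L-1̄ y)))
  (χ-no (y ≤L? ba Fin.zero ×-dec ba Fin.zero <L? y ×-dec x ≤L? ba Fin.zero)
        λ (_ , 1̄<y , _) → ℕₚ.<⇒≱ 1̄<y (≤L-1̄ y))

ρ-b-ω≡1 : ∀ {n} {{_ : NonZero n}} (j : Fin n) (o : un j ≤L ba j) →
  ρ (col (un j) (ba j) o) (proj₂ (ω (Fin.suc j))) ≡ 1ℤ
ρ-b-ω≡1 j _ = cong₂ _-_
  (cong₂ _+_ (χ-yes (un j ≤L? un j) ℕₚ.≤-refl) (χ-no (ba j ≤L? barNext j) j̄≰))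
  (χ-no (ba j ≤L? barNext j ×-dec un j <L? ba j ×-dec un j ≤L? un j) (j̄≰ ∘ proj₁))
  where
  j̄≰ : ¬ ba j ≤L barNext j
  j̄≰ = ℕₚ.<⇒≱ (barNext<ba j)

ρ-ba≡ρ-barNext : ∀ {n} {x' y' x : Letter n} (j : Fin n)
  (o : x' ≤L y') (p : x ≤L ba j) (q : x ≤L barNext j) → y' ≢ ba j →
  ρ (col x' y' o) (col x (ba j) p) ≡ ρ (col x' y' o) (col x (barNext j) q)
ρ-ba≡ρ-barNext {x' = x'} {y'} {x} j _ _ _ y'≢j̄ = cong₂ _-_
  (cong (χ (x' ≤L? x) +_) (χ-cong (y' ≤L? ba j) (y' ≤L? barNext j) to from))
  (χ-cong (y' ≤L? ba j ×-dec x <L? y' ×-dec x' ≤L? x)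
          (y' ≤L? barNext j ×-dec x <L? y' ×-dec x' ≤L? x) (map₁ to) (map₁ from))
  where
  to : y' ≤L ba j → y' ≤L barNext j
  to = ≤ba⇒≤barNext j y'≢j̄
  from : y' ≤L barNext j → y' ≤L ba j
  from y'≤ = ℕₚ.≤-trans y'≤ (ℕₚ.<⇒≤ (barNext<ba j))

ρ∞≡ρ-ω : ∀ {n} {{_ : NonZero n}} (j : Fin n) (c : SCol n) →
  ρ∞ (Fin.suc j) c ≡ ρ c (proj₂ (ω (Fin.suc j)))
ρ∞≡ρ-ω j (col x' (un k) o) with ⟨ col x' (un k) o ⟩ ≟B b (Fin.suc j)
... | yes ()
... | no _ = ρ-ba≡ρ-barNext {x' = x'} {un k} {un j} j o (un≤ba j) (un≤barNext j) λ ()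
ρ∞≡ρ-ω j (col x' (ba k) o) with ⟨ col x' (ba k) o ⟩ ≟B b (Fin.suc j)
... | yes refl = sym (ρ-b-ω≡1 j o)
... | no c≢b with k Fin.≟ j
...   | no k≢j = ρ-ba≡ρ-barNext {x' = x'} {ba k} {un j} j o (un≤ba j) (un≤barNext j)
                   λ { refl → k≢j refl }
...   | yes refl = cong₂ _-_
  (cong₂ _+_ (χ-cong (x' <L? un j) (x' ≤L? un j) ℕₚ.<⇒≤ (λ x'≤j → ≤L∧≢⇒<L x'≤j x'≢j))
             (trans (χ-no (ba j <L? ba j) j̄≮j̄) (sym (χ-no (ba j ≤L? barNext j) j̄≰))))
  (trans (χ-no (ba j <L? ba j ×-dec un j <L? ba j ×-dec x' <L? un j) (j̄≮j̄ ∘ proj₁))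
         (sym (χ-no (ba j ≤L? barNext j ×-dec un j <L? ba j ×-dec x' ≤L? un j) (j̄≰ ∘ proj₁))))
  where
  j̄≮j̄ : ¬ ba j <L ba j
  j̄≮j̄ = ℕₚ.<-irrefl refl
  j̄≰ : ¬ ba j ≤L barNext j
  j̄≰ = ℕₚ.<⇒≱ (barNext<ba j)
  x'≢j : x' ≢ un j
  x'≢j refl = c≢b (cong (λ o → ⟨ col (un j) (ba j) o ⟩) (ℕₚ.≤-irrelevant o (un≤ba j)))

+-cancelʳ-≤ : ∀ {i j} k → i + k ℤ.≤ j + k → i ℤ.≤ j
+-cancelʳ-≤ {i} {j} k i+k≤j+k =
  subst₂ ℤ._≤_ (+-k-cancel i) (+-k-cancel j) (ℤₚ.+-monoˡ-≤ (- k) i+k≤j+k)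
  where
  +-k-cancel : ∀ x → x + k - k ≡ x
  +-k-cancel x = trans (ℤₚ.+-assoc x k (- k))
    (trans (cong (x +_) (ℤₚ.+-inverseʳ k)) (ℤₚ.+-identityʳ x))

+-≤⇔ : ∀ {i j} k → i ℤ.≤ j ⇔ i + k ℤ.≤ j + k
+-≤⇔ k = mk⇔ (ℤₚ.+-monoˡ-≤ k) (+-cancelʳ-≤ k)

≫c∞⇔≫ω : ∀ {m} (i : Fin (suc (suc m))) (x : CI (suc m)) →
  ext x ≫[ i ] (0ℤ , c∞) ⇔ x ≫ ω i
≫c∞⇔≫ω Fin.zero (k , c) rewrite ρ-ω₀≡2 c | ℤₚ.+-identityʳ k = +-≤⇔ 1ℤ
≫c∞⇔≫ω (Fin.suc j) (k , c) rewrite ρ∞≡ρ-ω j c = ⇔.refl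

module _ {A B : Set} {R : B → B → Set} (f : A → B) {a : B} {a' : A}
         (R-last⇔ : ∀ x → R (f x) a ⇔ R (f x) (f a')) where

  Linked-map-snoc⇔ : ∀ xs → Linked R (map f xs ++ [ a ]) ⇔ Linked (R on f) (xs ++ [ a' ])
  Linked-map-snoc⇔ xs = mk⇔ (to xs) (from xs)
    where
    to : ∀ xs → Linked R (map f xs ++ [ a ]) → Linked (R on f) (xs ++ [ a' ])
    to []           _          = [-]
    to (x ∷ [])     (r ∷ [-])  = Equivalence.to (R-last⇔ x) r ∷ [-]
    to (x ∷ y ∷ xs) (r ∷ rs)   = r ∷ to (y ∷ xs) rs
    from : ∀ xs → Linked (R on f) (xs ++ [ a' ]) → Linked R (map f xs ++ [ a ])
    from []           _          = [-]
    from (x ∷ [])     (r ∷ [-])  = Equivalence.from (R-last⇔ x) r ∷ [-]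
    from (x ∷ y ∷ xs) (r ∷ rs)   = r ∷ from (y ∷ xs) rs

module _ {A L : Set} {P Q : A → Set} {l l' : L} (P⇔Q : ∀ a → P a ⇔ Q a)
         (P-irrelevant : Irrelevant P) (Q-irrelevant : Irrelevant Q) where

  replaceLast : Σ (A × L) (λ s → proj₂ s ≡ l × P (proj₁ s)) →
                Σ (A × L) (λ s → proj₂ s ≡ l' × Q (proj₁ s))
  replaceLast ((a , _) , _ , p) = (a , l') , refl , Equivalence.to (P⇔Q a) p

  replaceLast-bijective : Bijective _≡_ _≡_ replaceLast
  replaceLast-bijective = injective , surjective
    where
    injective : ∀ {x y} → replaceLast x ≡ replaceLast y → x ≡ y
    injective {(a , _) , refl , p} {(a' , _) , refl , p'} e with cong (proj₁ ∘ proj₁) e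
    ... | refl = cong (λ p → (a , l) , refl , p) (P-irrelevant p p')
    surjective : ∀ y → Σ _ λ x → ∀ {z} → z ≡ x → replaceLast z ≡ y
    surjective ((a , _) , refl , q) = ((a , l) , refl , Equivalence.from (P⇔Q a) q) ,
      λ { refl → cong (λ q → (a , l') , refl , q) (Q-irrelevant _ _) }

lemma4p4 : (n : ℕ) {{_ : NonZero n}} (i : Fin (suc n)) →
    Σ (𝒫 n i → 𝒫^ n (ω i)) λ φ →
      ((p : 𝒫 n i) → proj₁ (φ p) ≡ (proj₁ (proj₁ p) , asLast (ω i)))
      × Bijective _≡_ _≡_ φ
lemma4p4 (suc m) i =
  replaceLast chains⇔ chain-irrelevant chain-irrelevant ,
  (λ _ → refl) ,
  replaceLast-bijective chains⇔ chain-irrelevant chain-irrelevant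
  where
  chains⇔ : ∀ πs → Linked (λ p q → p ≫[ i ] q) (map ext πs ++ [ 0ℤ , c∞ ])
                  ⇔ Linked _≫_ (πs ++ [ ω i ])
  chains⇔ = Linked-map-snoc⇔ ext (≫c∞⇔≫ω i)
  chain-irrelevant : ∀ {A : Set} {f : A → A → ℤ} {g : A → A → ℤ} →
    Irrelevant (Linked (λ x y → f x y ℤ.≤ g x y))
  chain-irrelevant = Linked.irrelevant ℤₚ.≤-irrelevant
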